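{- Let $q$ be a prime power and $a,b,d,u$ integers with $1\le d$, and let $0\le i\le 2u-d$. Then $$\Lambda(q,a,b,d,u)\ge\Lambda(q,a+i,b+2u-d-i,2u,u)=A_q(\min\{a+i,b+2u-d-i\},2u;u),$$ and among the admissible $i$ this bound is strongest for $i=\max\{0,\min\{2u-d,\lfloor(b-a-d)/2\rfloor+u\}\}$.
   Context: $\Lambda(q,a,b,d,u)$ is the maximum size of a set of $a\times b$ matrices over $\mathbb{F}_q$ such that any two distinct elements $X,Y$ satisfy $\mathrm{rk}(X-Y)\ge d$ and every element has rank at most $u$. $A_q(v,d;k)$ is the maximum number of $k$-dimensional subspaces of $\mathbb{F}_q^v$ with pairwise subspace distance $\dim(U+W)-\dim(U\cap W)$ at least $d$. -}

module Defs where

open import Level using (0ℓ)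
open import Data.Nat as ℕ using (ℕ; zero; suc; _≤_)
open import Data.Nat.Primality using (Prime)
open import Data.Fin using (Fin; zero; suc)
open import Data.Product using (Σ; ∃; ∃-syntax; _×_; _,_)
open import Relation.Nullary using (¬_)
open import Relation.Binary.PropositionalEquality using (_≡_; _≢_; _≗_)
open import Algebra.Structures using (IsCommutativeRing)
open import Function.Bundles using (_↔_; _⇔_)

IsPrimePower : ℕ → Set
IsPrimePower q = ∃[ p ] ∃[ k ] (Prime p × 1 ≤ k × q ≡ p ℕ.^ k)

record Field : Set₁ where
  infixl 6 _+_
  infixl 7 _*_
  field
    Carrier : Set
    _+_ _*_ : Carrier → Carrier → Carrier
    -_      : Carrier → Carrier
    0# 1#   : Carrier
    isCommutativeRing : IsCommutativeRing _≡_ _+_ _*_ -_ 0# 1#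
    0≢1     : 0# ≢ 1#
    inverse : ∀ x → x ≢ 0# → ∃[ y ] (x * y ≡ 1#)

record FiniteField (q : ℕ) : Set₁ where
  field
    field′ : Field
    enumeration : Fin q ↔ Field.Carrier field′
  open Field field′ public

module LinearAlgebra (F : Field) where
  open Field F

  Vector : ℕ → Set
  Vector n = Fin n → Carrier

  Matrix : ℕ → ℕ → Set
  Matrix a b = Fin a → Fin b → Carrier

  sum : (k : ℕ) → (Fin k → Carrier) → Carrier
  sum zero    f = 0#
  sum (suc k) f = f zero + sum k (λ j → f (suc j))

  lincomb : {k n : ℕ} → (Fin k → Carrier) → (Fin k → Vector n) → Vector n
  lincomb {k} c vs x = sum k (λ j → c j * vs j x)

  zeroV : {n : ℕ} → Vector n
  zeroV _ = 0#

  _+V_ : {n : ℕ} → Vector n → Vector n → Vector n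
  (u +V w) x = u x + w x

  LinIndep : {k n : ℕ} → (Fin k → Vector n) → Set
  LinIndep {k} vs = ∀ (c : Fin k → Carrier) → lincomb c vs ≗ zeroV → ∀ j → c j ≡ 0#

  _-M_ : {a b : ℕ} → Matrix a b → Matrix a b → Matrix a b
  (X -M Y) i j = X i j + (- Y i j)

  column : {a b : ℕ} → Matrix a b → Fin b → Vector a
  column M j i = M i j

  RankAtLeast : {a b : ℕ} → Matrix a b → ℕ → Set
  RankAtLeast {a} {b} M r = Σ (Fin r → Fin b) λ f → LinIndep {r} {a} (λ j → column M (f j))

  RankAtMost : {a b : ℕ} → Matrix a b → ℕ → Set
  RankAtMost M u = ¬ RankAtLeast M (suc u)

  -- A set of N distinct a×b matrices, each of rank ≤ u, with pairwise
  -- rank distance ≥ d.   (Λ(q,a,b,d,u) = max such N.)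
  RankMetricCode : (a b d u N : ℕ) → Set
  RankMetricCode a b d u N =
    Σ (Fin N → Matrix a b) λ C →
      (∀ k l → (∀ i j → C k i j ≡ C l i j) → k ≡ l) ×
      (∀ k → RankAtMost (C k) u) ×
      (∀ k l → k ≢ l → RankAtLeast (C k -M C l) d)

  record Subspace (v : ℕ) : Set₁ where
    field
      mem     : Vector v → Set
      ∈-zero  : mem zeroV
      ∈-+     : ∀ {x y} → mem x → mem y → mem (x +V y)
      ∈-scale : ∀ c {x} → mem x → mem (λ i → c * x i)
      ∈-resp  : ∀ {x y} → x ≗ y → mem x → mem y
  open Subspace public

  HasDim : {v : ℕ} → (Vector v → Set) → ℕ → Set
  HasDim {v} P k =
    Σ (Fin k → Vector v) λ B →
      (∀ j → P (B j)) × LinIndep B ×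
      (∀ x → P x → ∃[ c ] (x ≗ lincomb c B))

  _∩S_ : {v : ℕ} → Subspace v → Subspace v → Vector v → Set
  (U ∩S W) x = mem U x × mem W x

  _+S_ : {v : ℕ} → Subspace v → Subspace v → Vector v → Set
  (U +S W) x = ∃[ y ] ∃[ z ] (mem U y × mem W z × x ≗ (y +V z))

  SubspaceDistAtLeast : {v : ℕ} → Subspace v → Subspace v → ℕ → Set
  SubspaceDistAtLeast U W δ =
    ∀ s t → HasDim (U +S W) s → HasDim (U ∩S W) t → δ ℕ.+ t ≤ s

  SameSubspace : {v : ℕ} → Subspace v → Subspace v → Set
  SameSubspace U W = ∀ x → (mem U x ⇔ mem W x)

  -- A set of N distinct k-dimensional subspaces of F^v with pairwise
  -- subspace distance ≥ δ.   (A_q(v,δ;k) = max such N.)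
  ConstantDimCode : (v δ k N : ℕ) → Set₁
  ConstantDimCode v δ k N =
    Σ (Fin N → Subspace v) λ C →
      (∀ j → HasDim (mem (C j)) k) ×
      (∀ j l → SameSubspace (C j) (C l) → j ≡ l) ×
      (∀ j l → j ≢ l → SubspaceDistAtLeast (C j) (C l) δ)

  ΛLe : (a b d u a′ b′ d′ u′ : ℕ) → Set
  ΛLe a b d u a′ b′ d′ u′ = ∀ N → RankMetricCode a b d u N → RankMetricCode a′ b′ d′ u′ N

  ΛEqA : (a b d u v δ k : ℕ) → Set₁
  ΛEqA a b d u v δ k =
    (∀ N → RankMetricCode a b d u N → ConstantDimCode v δ k N) ×
    (∀ N → ConstantDimCode v δ k N → RankMetricCode a b d u N)

open import Data.Integer as ℤ using (ℤ; +_; 0ℤ)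

optimalShift : (a b d u : ℕ) → ℤ
optimalShift a b d u =
  0ℤ ℤ.⊔ ((+ (2 ℕ.* u) ℤ.- + d) ℤ.⊓ (((+ b ℤ.- + a ℤ.- + d) ℤ./ℕ 2) ℤ.+ + u))

-- Deleting i rows and 2u − d − i columns lowers rank distances by at most 2u − d, so puncturing a code of
-- distance 2u gives one of distance d.  In a code of rank ≤ u and distance 2u with at least two words, every
-- word has rank exactly u (rank(X − Y) ≥ 2u), and the column spaces of two words meet trivially: they form a
-- partial spread of u-spaces.  Conversely, bases B_k of a partial spread in F^v (v ≤ a, b) give the code
-- X_k = B_k B_kᵀ, since X_k − X_l = [B_k B_l] [B_k −B_l]ᵀ is a product of two full-rank 2u-column matrices.
-- Transposing if necessary, Λ(q,a,b,2u,u) = A_q(min(a,b),2u;u), which is monotone in min(a,b); the best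
-- shift is therefore the one maximising min(a + i, b + 2u − d − i) over 0 ≤ i ≤ 2u − d.

module Submission where

open import Algebra.Bundles using (CommutativeRing)
import Algebra.Properties.CommutativeSemigroup as CommutativeSemigroupProperties
import Algebra.Properties.Ring as RingProperties
import Algebra.Properties.Semiring.Sum as SemiringSum
open import Data.Empty using (⊥-elim)
open import Data.Fin as Fin using (Fin; zero; suc; punchIn; punchOut; _↑ˡ_; _↑ʳ_)
import Data.Fin.Properties as Finₚ
open import Data.Nat as ℕ using (ℕ; zero; suc; z≤n; s≤s)
import Data.Nat.Properties as ℕₚ
open import Data.Product using (Σ; ∃; ∃-syntax; _×_; _,_; proj₁; proj₂)
open import Data.Sum using (_⊎_; inj₁; inj₂)
open import Data.Vec.Functional using (_∷_; _++_; insertAt; removeAt)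
open import Data.Vec.Functional.Relation.Unary.All.Properties using (++⁺)
open import Data.Vec.Functional.Properties using (lookup-++ˡ; lookup-++ʳ; insertAt-lookup; insertAt-punchIn; removeAt-punchOut)
open import Function using (_∘_; _↔_; Inverse; Equivalence)
open import Function.Properties.Inverse using (↔-sym; ↔⇒↣)
open import Relation.Binary.PropositionalEquality
open import Relation.Nullary using (¬_; Dec; yes; no; ¬?; _×-dec_)
open import Relation.Nullary.Decidable using (map′; decidable-stable; via-injection)
open import Relation.Binary.Definitions using (DecidableEquality)

open import Defs

++-zipWith : ∀ {m k} {A B C : Set} (_⊗_ : A → B → C)
  (f : Fin m → A) (g : Fin k → A) (h : Fin m → B) (l : Fin k → B) →
  (λ j → (f ++ g) j ⊗ (h ++ l) j) ≗ (λ j → f j ⊗ h j) ++ (λ j → g j ⊗ l j)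
++-zipWith {m} _⊗_ f g h l j with Fin.splitAt m j
... | inj₁ _ = refl
... | inj₂ _ = refl

++-map : ∀ {m k} {A B : Set} (f : A → B) (xs : Fin m → A) (ys : Fin k → A) →
  f ∘ (xs ++ ys) ≗ (f ∘ xs) ++ (f ∘ ys)
++-map {m} f xs ys j with Fin.splitAt m j
... | inj₁ _ = refl
... | inj₂ _ = refl

splitAt-++ : ∀ m {k} {A : Set} (c : Fin (m ℕ.+ k) → A) → (λ j → c (j ↑ˡ k)) ++ (λ j → c (m ↑ʳ j)) ≗ c
splitAt-++ m c J with Fin.splitAt m J in eq
... | inj₁ j = cong c (Finₚ.splitAt⁻¹-↑ˡ eq)
... | inj₂ j = cong c (Finₚ.splitAt⁻¹-↑ʳ eq)

u+u≡2*u : ∀ u → u ℕ.+ u ≡ 2 ℕ.* u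
u+u≡2*u u = cong (u ℕ.+_) (sym (ℕₚ.+-identityʳ u))

module Sums (F : Field) where
  open Field F
  open LinearAlgebra F

  commutativeRing : CommutativeRing _ _
  commutativeRing = record { isCommutativeRing = isCommutativeRing }

  open CommutativeRing commutativeRing public
    using (+-assoc; +-comm; +-identityˡ; +-identityʳ; -‿inverseʳ;
           *-assoc; *-comm; *-identityˡ; *-identityʳ; distribˡ; distribʳ; zeroˡ; zeroʳ)
  open RingProperties (CommutativeRing.ring commutativeRing) public
    using (-1*x≈-x; -‿involutive; -0#≈0#; -‿distribˡ-*; -‿distribʳ-*; -‿+-comm; +-inverseˡ-unique)
  open CommutativeSemigroupProperties (CommutativeRing.*-commutativeSemigroup commutativeRing) public
    using () renaming (x∙yz≈y∙xz to *-leftComm)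
  private
    module ∑ = SemiringSum (CommutativeRing.semiring commutativeRing)
  open ≡-Reasoning

  -- Defs' sum unfolds exactly like the library's, so the library's lemmas transfer along this.
  sum≡∑ : ∀ k (f : Fin k → Carrier) → sum k f ≡ ∑.sum f
  sum≡∑ zero    f = refl
  sum≡∑ (suc k) f = cong (f zero +_) (sum≡∑ k (f ∘ suc))

  sum-cong : ∀ k {f g : Fin k → Carrier} → f ≗ g → sum k f ≡ sum k g
  sum-cong zero    f≗g = refl
  sum-cong (suc k) f≗g = cong₂ _+_ (f≗g zero) (sum-cong k (f≗g ∘ suc))

  sum-zero : ∀ k {f : Fin k → Carrier} → (∀ j → f j ≡ 0#) → sum k f ≡ 0#
  sum-zero zero    f≡0 = refl
  sum-zero (suc k) f≡0 = trans (cong₂ _+_ (f≡0 zero) (sum-zero k (f≡0 ∘ suc))) (+-identityˡ 0#)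

  sum-distrib-+ : ∀ k (f g : Fin k → Carrier) → sum k (λ j → f j + g j) ≡ sum k f + sum k g
  sum-distrib-+ k f g = begin
    sum k (λ j → f j + g j) ≡⟨ sum≡∑ k _ ⟩
    ∑.sum (λ j → f j + g j) ≡⟨ ∑.∑-distrib-+ f g ⟩
    ∑.sum f + ∑.sum g       ≡⟨ cong₂ _+_ (sum≡∑ k f) (sum≡∑ k g) ⟨
    sum k f + sum k g       ∎

  *-distribˡ-sum : ∀ k x (f : Fin k → Carrier) → x * sum k f ≡ sum k (λ j → x * f j)
  *-distribˡ-sum k x f = begin
    x * sum k f              ≡⟨ cong (x *_) (sum≡∑ k f) ⟩
    x * ∑.sum f              ≡⟨ ∑.*-distribˡ-sum x f ⟩
    ∑.sum (λ j → x * f j)    ≡⟨ sum≡∑ k _ ⟨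
    sum k (λ j → x * f j)    ∎

  *-distribʳ-sum : ∀ k x (f : Fin k → Carrier) → sum k f * x ≡ sum k (λ j → f j * x)
  *-distribʳ-sum k x f = begin
    sum k f * x              ≡⟨ cong (_* x) (sum≡∑ k f) ⟩
    ∑.sum f * x              ≡⟨ ∑.*-distribʳ-sum x f ⟩
    ∑.sum (λ j → f j * x)    ≡⟨ sum≡∑ k _ ⟨
    sum k (λ j → f j * x)    ∎

  -‿distrib-sum : ∀ k (f : Fin k → Carrier) → - sum k f ≡ sum k (λ j → - f j)
  -‿distrib-sum zero    f = -0#≈0#
  -‿distrib-sum (suc k) f = begin
    - (f zero + sum k (f ∘ suc))     ≡⟨ -‿+-comm (f zero) _ ⟨
    - f zero + - sum k (f ∘ suc)     ≡⟨ cong (- f zero +_) (-‿distrib-sum k (f ∘ suc)) ⟩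
    - f zero + sum k (λ j → - f (suc j)) ∎

  sum-comm : ∀ k m (f : Fin k → Fin m → Carrier) →
    sum k (λ j → sum m (f j)) ≡ sum m (λ l → sum k (λ j → f j l))
  sum-comm k m f = begin
    sum k (λ j → sum m (f j))           ≡⟨ sum-cong k (λ j → sum≡∑ m (f j)) ⟩
    sum k (λ j → ∑.sum (f j))           ≡⟨ sum≡∑ k _ ⟩
    ∑.sum (λ j → ∑.sum (f j))           ≡⟨ ∑.∑-comm f ⟩
    ∑.sum (λ l → ∑.sum (λ j → f j l))   ≡⟨ sum≡∑ m _ ⟨
    sum m (λ l → ∑.sum (λ j → f j l))   ≡⟨ sum-cong m (λ l → sum≡∑ k _) ⟨
    sum m (λ l → sum k (λ j → f j l))   ∎

  sum-remove : ∀ k (f : Fin (suc k) → Carrier) i → sum (suc k) f ≡ f i + sum k (removeAt f i)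
  sum-remove k f i = begin
    sum (suc k) f                   ≡⟨ sum≡∑ (suc k) f ⟩
    ∑.sum f                         ≡⟨ ∑.sum-remove f ⟩
    f i + ∑.sum (removeAt f i)      ≡⟨ cong (f i +_) (sum≡∑ k _) ⟨
    f i + sum k (removeAt f i)      ∎

  sum-++ : ∀ m k (f : Fin m → Carrier) (g : Fin k → Carrier) →
    sum (m ℕ.+ k) (f ++ g) ≡ sum m f + sum k g
  sum-++ m k f g = begin
    sum (m ℕ.+ k) (f ++ g)                               ≡⟨ split m ⟩
    sum m (λ j → (f ++ g) (j ↑ˡ k)) + sum k (λ j → (f ++ g) (m ↑ʳ j))
      ≡⟨ cong₂ _+_ (sum-cong m (lookup-++ˡ f g)) (sum-cong k (lookup-++ʳ f g)) ⟩
    sum m f + sum k g                                    ∎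
    where
    split : ∀ m {h : Fin (m ℕ.+ k) → Carrier} →
      sum (m ℕ.+ k) h ≡ sum m (λ j → h (j ↑ˡ k)) + sum k (λ j → h (m ↑ʳ j))
    split zero    = sym (+-identityˡ _)
    split (suc m) = trans (cong (_ +_) (split m)) (sym (+-assoc _ _ _))

module Spans (F : Field) where
  open Field F
  open LinearAlgebra F
  open Sums F
  open ≡-Reasoning

  δ : ∀ {k} → Fin k → Fin k → Carrier
  δ zero    zero    = 1#
  δ zero    (suc j) = 0#
  δ (suc i) zero    = 0#
  δ (suc i) (suc j) = δ i j

  δ-diag : ∀ {k} (i : Fin k) → δ i i ≡ 1#
  δ-diag zero    = refl
  δ-diag (suc i) = δ-diag i

  δ-sym : ∀ {k} (i j : Fin k) → δ i j ≡ δ j i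
  δ-sym zero    zero    = refl
  δ-sym zero    (suc j) = refl
  δ-sym (suc i) zero    = refl
  δ-sym (suc i) (suc j) = δ-sym i j

  sum-δ : ∀ k (i : Fin k) (f : Fin k → Carrier) → sum k (λ j → δ i j * f j) ≡ f i
  sum-δ (suc k) zero f = begin
    1# * f zero + sum k (λ j → 0# * f (suc j)) ≡⟨ cong₂ _+_ (*-identityˡ _) (sum-zero k (λ j → zeroˡ _)) ⟩
    f zero + 0#                                ≡⟨ +-identityʳ _ ⟩
    f zero                                     ∎
  sum-δ (suc k) (suc i) f = trans (cong₂ _+_ (zeroˡ _) (sum-δ k i (f ∘ suc))) (+-identityˡ _)

  lincomb-cong : ∀ {k n} {c d : Fin k → Carrier} {vs ws : Fin k → Vector n} →
    c ≗ d → (∀ j → vs j ≗ ws j) → lincomb c vs ≗ lincomb d ws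
  lincomb-cong {k} c≗d vs≗ws x = sum-cong k (λ j → cong₂ _*_ (c≗d j) (vs≗ws j x))

  lincomb-congˡ : ∀ {k n} {c d : Fin k → Carrier} (vs : Fin k → Vector n) → c ≗ d → lincomb c vs ≗ lincomb d vs
  lincomb-congˡ vs c≗d = lincomb-cong c≗d (λ _ _ → refl)

  lincomb-δ : ∀ {k n} (i : Fin k) (vs : Fin k → Vector n) → lincomb (δ i) vs ≗ vs i
  lincomb-δ {k} i vs x = sum-δ k i (λ j → vs j x)

  lincomb-zero : ∀ {k n} (vs : Fin k → Vector n) → lincomb (λ _ → 0#) vs ≗ zeroV
  lincomb-zero {k} vs x = sum-zero k (λ j → zeroˡ _)

  lincomb-+ : ∀ {k n} (c d : Fin k → Carrier) (vs : Fin k → Vector n) x →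
    lincomb (λ j → c j + d j) vs x ≡ lincomb c vs x + lincomb d vs x
  lincomb-+ {k} c d vs x = trans (sum-cong k (λ j → distribʳ _ (c j) (d j))) (sum-distrib-+ k _ _)

  lincomb-* : ∀ {k n} a (c : Fin k → Carrier) (vs : Fin k → Vector n) x →
    lincomb (λ j → a * c j) vs x ≡ a * lincomb c vs x
  lincomb-* {k} a c vs x = trans (sum-cong k (λ j → *-assoc a (c j) (vs j x))) (sym (*-distribˡ-sum k a _))

  lincomb-neg : ∀ {k n} (c : Fin k → Carrier) (vs : Fin k → Vector n) x →
    lincomb (λ j → - c j) vs x ≡ - lincomb c vs x
  lincomb-neg {k} c vs x = trans (sum-cong k (λ j → sym (-‿distribˡ-* (c j) (vs j x)))) (sym (-‿distrib-sum k _))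

  lincomb-+-* : ∀ {k n} (c d : Fin k → Carrier) a (vs : Fin k → Vector n) x →
    lincomb (λ j → c j + - (a * d j)) vs x ≡ lincomb c vs x + - (a * lincomb d vs x)
  lincomb-+-* c d a vs x = begin
    lincomb (λ j → c j + - (a * d j)) vs x          ≡⟨ lincomb-+ c _ vs x ⟩
    lincomb c vs x + lincomb (λ j → - (a * d j)) vs x ≡⟨ cong (_ +_) (lincomb-neg _ vs x) ⟩
    lincomb c vs x + - lincomb (λ j → a * d j) vs x  ≡⟨ cong (λ t → _ + - t) (lincomb-* a d vs x) ⟩
    lincomb c vs x + - (a * lincomb d vs x)          ∎

  lincomb-++ : ∀ {m k n} (c : Fin m → Carrier) (d : Fin k → Carrier) (vs : Fin m → Vector n) (ws : Fin k → Vector n) x →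
    lincomb (c ++ d) (vs ++ ws) x ≡ lincomb c vs x + lincomb d ws x
  lincomb-++ {m} {k} c d vs ws x = begin
    sum (m ℕ.+ k) (λ j → (c ++ d) j * (vs ++ ws) j x)
      ≡⟨ sum-cong (m ℕ.+ k) (++-zipWith (λ a v → a * v x) c d vs ws) ⟩
    sum (m ℕ.+ k) ((λ j → c j * vs j x) ++ (λ j → d j * ws j x)) ≡⟨ sum-++ m k _ _ ⟩
    lincomb c vs x + lincomb d ws x ∎

  infix 4 _∈⟨_⟩ _⊆⟨_⟩

  _∈⟨_⟩ : ∀ {k n} → Vector n → (Fin k → Vector n) → Set
  x ∈⟨ vs ⟩ = ∃[ c ] (x ≗ lincomb c vs)

  _⊆⟨_⟩ : ∀ {m k n} → (Fin m → Vector n) → (Fin k → Vector n) → Set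
  ws ⊆⟨ vs ⟩ = ∀ j → ws j ∈⟨ vs ⟩

  ⟨_⟩ : ∀ {k n} → (Fin k → Vector n) → Subspace n
  ⟨ vs ⟩ = record
    { mem     = _∈⟨ vs ⟩
    ; ∈-zero  = (λ _ → 0#) , (λ x → sym (lincomb-zero vs x))
    ; ∈-+     = λ { (c , x≗) (d , y≗) → (λ j → c j + d j) ,
                    λ i → trans (cong₂ _+_ (x≗ i) (y≗ i)) (sym (lincomb-+ c d vs i)) }
    ; ∈-scale = λ { a (c , x≗) → (λ j → a * c j) , λ i → trans (cong (a *_) (x≗ i)) (sym (lincomb-* a c vs i)) }
    ; ∈-resp  = λ { x≗y (c , x≗) → c , λ i → trans (sym (x≗y i)) (x≗ i) }
    }

  lincomb∈ : ∀ {k n} (U : Subspace n) {vs : Fin k → Vector n} → (∀ j → mem U (vs j)) → ∀ c → mem U (lincomb c vs)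
  lincomb∈ {zero}  U vs⊆U c = ∈-zero U
  lincomb∈ {suc k} U vs⊆U c = ∈-+ U (∈-scale U (c zero) (vs⊆U zero)) (lincomb∈ U (vs⊆U ∘ suc) (c ∘ suc))

  ∈⟨⟩-resp : ∀ {k n} {vs : Fin k → Vector n} {x y} → x ≗ y → x ∈⟨ vs ⟩ → y ∈⟨ vs ⟩
  ∈⟨⟩-resp = ∈-resp ⟨ _ ⟩

  ∈⟨⟩-member : ∀ {k n} (vs : Fin k → Vector n) j → vs j ∈⟨ vs ⟩
  ∈⟨⟩-member vs j = δ j , λ x → sym (lincomb-δ j vs x)

  lincomb-lincomb : ∀ {k m n} (c : Fin k → Carrier) (a : Fin k → Fin m → Carrier) (ws : Fin m → Vector n) x →
    lincomb c (λ j → lincomb (a j) ws) x ≡ lincomb (λ l → sum k (λ j → c j * a j l)) ws x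
  lincomb-lincomb {k} {m} c a ws x = begin
    sum k (λ j → c j * sum m (λ l → a j l * ws l x))   ≡⟨ sum-cong k (λ j → *-distribˡ-sum m (c j) _) ⟩
    sum k (λ j → sum m (λ l → c j * (a j l * ws l x))) ≡⟨ sum-comm k m _ ⟩
    sum m (λ l → sum k (λ j → c j * (a j l * ws l x)))
      ≡⟨ sum-cong m (λ l → trans (sum-cong k (λ j → sym (*-assoc _ _ _))) (sym (*-distribʳ-sum k (ws l x) _))) ⟩
    sum m (λ l → sum k (λ j → c j * a j l) * ws l x)  ∎

  ∈⟨⟩-trans : ∀ {k m n} {vs : Fin k → Vector n} {ws : Fin m → Vector n} →
    vs ⊆⟨ ws ⟩ → ∀ {x} → x ∈⟨ vs ⟩ → x ∈⟨ ws ⟩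
  ∈⟨⟩-trans {k} {m} {vs = vs} {ws} vs⊆ws {x} (c , x≗) = _ , λ i → begin
    x i                                          ≡⟨ x≗ i ⟩
    lincomb c vs i                               ≡⟨ lincomb-cong (λ _ → refl) (λ j → proj₂ (vs⊆ws j)) i ⟩
    lincomb c (λ j → lincomb (a j) ws) i         ≡⟨ lincomb-lincomb c a ws i ⟩
    lincomb _ ws i                               ∎
    where
    a : Fin k → Fin m → Carrier
    a j = proj₁ (vs⊆ws j)

  ∈⟨⟩-tail : ∀ {k n} {vs : Fin (suc k) → Vector n} {x} c →
    x ≗ lincomb c vs → c zero ≡ 0# → x ∈⟨ vs ∘ suc ⟩
  ∈⟨⟩-tail {n = n} {vs} {x} c x≗ c₀≡0 = c ∘ suc , λ i → begin
    x i                          ≡⟨ x≗ i ⟩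
    c zero * vs zero i + rest i  ≡⟨ cong (λ a → a * vs zero i + rest i) c₀≡0 ⟩
    0# * vs zero i + rest i      ≡⟨ cong (_+ rest i) (zeroˡ _) ⟩
    0# + rest i                  ≡⟨ +-identityˡ _ ⟩
    rest i                       ∎
    where
    rest : Vector n
    rest = lincomb (c ∘ suc) (vs ∘ suc)

  ∈⟨⟩-++ : ∀ {m k n} {vs : Fin m → Vector n} {ws : Fin k → Vector n} {x y} →
    x ∈⟨ vs ⟩ → y ∈⟨ ws ⟩ → (x +V y) ∈⟨ vs ++ ws ⟩
  ∈⟨⟩-++ {vs = vs} {ws} {x} {y} (c , x≗) (d , y≗) =
    c ++ d , λ i → trans (cong₂ _+_ (x≗ i) (y≗ i)) (sym (lincomb-++ c d vs ws i))

  ∈⟨⟩-++ˡ : ∀ {m k n} {vs : Fin m → Vector n} (ws : Fin k → Vector n) {x} → x ∈⟨ vs ⟩ → x ∈⟨ vs ++ ws ⟩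
  ∈⟨⟩-++ˡ ws x∈ = ∈⟨⟩-resp (λ i → +-identityʳ _) (∈⟨⟩-++ x∈ (∈-zero ⟨ ws ⟩))

  ∈⟨⟩-++ʳ : ∀ {m k n} (vs : Fin m → Vector n) {ws : Fin k → Vector n} {x} → x ∈⟨ ws ⟩ → x ∈⟨ vs ++ ws ⟩
  ∈⟨⟩-++ʳ vs x∈ = ∈⟨⟩-resp (λ i → +-identityˡ _) (∈⟨⟩-++ (∈-zero ⟨ vs ⟩) x∈)

  ∈⟨⟩-difference : ∀ {m k n} {vs : Fin m → Vector n} {ws : Fin k → Vector n} {x y} →
    x ∈⟨ vs ⟩ → y ∈⟨ ws ⟩ → (λ i → x i + - y i) ∈⟨ vs ++ ws ⟩
  ∈⟨⟩-difference {ws = ws} x∈ (d , y≗) =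
    ∈⟨⟩-++ x∈ ((λ j → - d j) , λ i → trans (cong -_ (y≗ i)) (sym (lincomb-neg d ws i)))

  δ-expansion : ∀ {n} (x : Vector n) → x ≗ lincomb x δ
  δ-expansion {n} x i = sym (begin
    sum n (λ j → x j * δ j i) ≡⟨ sum-cong n (λ j → trans (*-comm _ _) (cong (_* x j) (δ-sym j i))) ⟩
    sum n (λ j → δ i j * x j) ≡⟨ sum-δ n i x ⟩
    x i                       ∎)

  δ-independent : ∀ {n} → LinIndep (δ {n})
  δ-independent c lincomb≗0 i = trans (δ-expansion c i) (lincomb≗0 i)

  LinIndep-resp : ∀ {k n} {vs ws : Fin k → Vector n} → (∀ j → vs j ≗ ws j) → LinIndep vs → LinIndep ws
  LinIndep-resp vs≗ws vs-indep c lincomb≗0 =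
    vs-indep c (λ x → trans (lincomb-cong (λ _ → refl) vs≗ws x) (lincomb≗0 x))

  independent⇒nonzero : ∀ {k n} (vs : Fin k → Vector n) → LinIndep vs → ∀ j → ¬ vs j ≗ zeroV
  independent⇒nonzero vs vs-indep j vs≗0 =
    0≢1 (sym (trans (sym (δ-diag j)) (vs-indep (δ j) (λ x → trans (lincomb-δ j vs x) (vs≗0 x)) j)))

  independent-tail : ∀ {k n} (vs : Fin (suc k) → Vector n) → LinIndep vs → LinIndep (vs ∘ suc)
  independent-tail vs vs-indep c lincomb≗0 j =
    vs-indep (0# ∷ c) (λ x → trans (cong (_+ lincomb c (vs ∘ suc) x) (zeroˡ (vs zero x)))
                                  (trans (+-identityˡ _) (lincomb≗0 x))) (suc j)

  dependent⇒∈⟨removeAt⟩ : ∀ {k n} (vs : Fin (suc k) → Vector n) (c : Fin (suc k) → Carrier) →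
    lincomb c vs ≗ zeroV → ∀ i → c i ≢ 0# → vs i ∈⟨ removeAt vs i ⟩
  dependent⇒∈⟨removeAt⟩ {k} {n} vs c lincomb≗0 i cᵢ≢0 = d , λ x → begin
    vs i x                     ≡⟨ *-identityˡ (vs i x) ⟨
    1# * vs i x                ≡⟨ cong (_* vs i x) (trans (sym cᵢβ≡1) (*-comm _ _)) ⟩
    (β * c i) * vs i x         ≡⟨ *-assoc _ _ _ ⟩
    β * (c i * vs i x)
      ≡⟨ cong (β *_) (+-inverseˡ-unique _ _ (trans (sym (sum-remove k (λ j → c j * vs j x) i)) (lincomb≗0 x))) ⟩
    β * - rest x               ≡⟨ -‿distribʳ-* β (rest x) ⟨
    - (β * rest x)             ≡⟨ cong -_ (lincomb-* β (removeAt c i) (removeAt vs i) x) ⟨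
    - lincomb (λ j → β * c (punchIn i j)) (removeAt vs i) x ≡⟨ lincomb-neg _ (removeAt vs i) x ⟨
    lincomb d (removeAt vs i) x ∎
    where
    β : Carrier
    β = proj₁ (inverse (c i) cᵢ≢0)
    cᵢβ≡1 : c i * β ≡ 1#
    cᵢβ≡1 = proj₂ (inverse (c i) cᵢ≢0)
    d : Fin k → Carrier
    d j = - (β * c (punchIn i j))
    rest : Vector n
    rest = lincomb (removeAt c i) (removeAt vs i)

module Dimension (F : Field) {q : ℕ} (enumeration : Fin q ↔ Field.Carrier F) where
  open Field F
  open LinearAlgebra F
  open Sums F
  open Spans F
  open Inverse enumeration using (to; from; strictlyInverseˡ)
  open ≡-Reasoning

  _≟_ : DecidableEquality Carrier
  _≟_ = via-injection (↔⇒↣ (↔-sym enumeration)) Finₚ._≟_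

  ∃-scalar? : (P : Carrier → Set) → (∀ x → Dec (P x)) → Dec (∃ P)
  ∃-scalar? P P? = map′ (λ { (i , p) → to i , p })
                        (λ { (x , p) → from x , subst P (sym (strictlyInverseˡ x)) p })
                        (Finₚ.any? (P? ∘ to))

  -- Vectors are functions, so a search over F^k can only decide predicates invariant under ≗.
  Extensional : ∀ {k} → (Vector k → Set) → Set
  Extensional P = ∀ {c d} → c ≗ d → P c → P d

  ∃-vector? : ∀ k (P : Vector k → Set) → Extensional P → (∀ c → Dec (P c)) → Dec (∃ P)
  ∃-vector? zero    P P-ext P? = map′ (λ p → _ , p) (λ { (c , p) → P-ext (λ ()) p }) (P? (λ ()))
  ∃-vector? (suc k) P P-ext P? =
    map′ (λ { (x , c , p) → x ∷ c , p })
         (λ { (c , p) → c zero , c ∘ suc , P-ext (λ { zero → refl ; (suc j) → refl }) p })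
         (∃-scalar? (λ x → ∃ λ c → P (x ∷ c))
           (λ x → ∃-vector? k (λ c → P (x ∷ c)) (λ c≗d → P-ext (λ { zero → refl ; (suc j) → c≗d j }))
                            (λ c → P? (x ∷ c))))

  _≗?_ : ∀ {n} (x y : Vector n) → Dec (x ≗ y)
  x ≗? y = Finₚ.all? (λ i → x i ≟ y i)

  _∈⟨_⟩? : ∀ {k n} x (vs : Fin k → Vector n) → Dec (x ∈⟨ vs ⟩)
  _∈⟨_⟩? {k} x vs = ∃-vector? k (λ c → x ≗ lincomb c vs)
    (λ c≗d x≗ i → trans (x≗ i) (lincomb-congˡ vs c≗d i)) (λ c → x ≗? lincomb c vs)

  Dependence : ∀ {k n} → (Fin k → Vector n) → Set
  Dependence vs = ∃ λ c → lincomb c vs ≗ zeroV × ∃ λ j → c j ≢ 0#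

  independent-or-dependent : ∀ {k n} (vs : Fin k → Vector n) → LinIndep vs ⊎ Dependence vs
  independent-or-dependent {k} vs
    with ∃-vector? k _ ext (λ c → (lincomb c vs ≗? zeroV) ×-dec Finₚ.any? (λ j → ¬? (c j ≟ 0#)))
    where
    ext : Extensional (λ c → lincomb c vs ≗ zeroV × ∃ λ j → c j ≢ 0#)
    ext c≗d (≗0 , j , cⱼ≢0) = (λ x → trans (sym (lincomb-congˡ vs c≗d x)) (≗0 x)) , j , cⱼ≢0 ∘ trans (c≗d j)
  ... | yes dependence = inj₂ dependence
  ... | no ¬dependence = inj₁ λ c ≗0 j → decidable-stable (c j ≟ 0#) (λ cⱼ≢0 → ¬dependence (c , ≗0 , j , cⱼ≢0))

  ∷-independent : ∀ {k n} x (vs : Fin k → Vector n) → LinIndep vs → ¬ x ∈⟨ vs ⟩ → LinIndep (x ∷ vs)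
  ∷-independent x vs vs-indep x∉ c ≗0 = λ { zero → c₀≡0 ; (suc j) → tail≡0 j }
    where
    c₀≡0 : c zero ≡ 0#
    c₀≡0 = decidable-stable (c zero ≟ 0#) (λ c₀≢0 → x∉ (dependent⇒∈⟨removeAt⟩ (x ∷ vs) c ≗0 zero c₀≢0))
    tail≡0 : ∀ j → c (suc j) ≡ 0#
    tail≡0 = vs-indep (c ∘ suc) (λ i → sym (proj₂ (∈⟨⟩-tail {vs = x ∷ vs} c (λ i → sym (≗0 i)) c₀≡0) i))

  shear-independent : ∀ {s n} (w : Fin (suc s) → Vector n) → LinIndep w →
    ∀ i (a : Fin s → Carrier) → LinIndep (λ k y → w (punchIn i k) y + - (a k * w i y))
  shear-independent {s} w w-indep i a e ≗0 k =
    trans (sym (insertAt-punchIn e i (- Λ) k)) (w-indep E E≗0 (punchIn i k))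
    where
    Λ : Carrier
    Λ = sum s (λ k → e k * a k)
    E : Fin (suc s) → Carrier
    E = insertAt e i (- Λ)
    E≗0 : lincomb E w ≗ zeroV
    E≗0 y = begin
      lincomb E w y                                   ≡⟨ sum-remove s (λ j → E j * w j y) i ⟩
      E i * w i y + sum s (λ k → E (punchIn i k) * w (punchIn i k) y)
        ≡⟨ cong₂ _+_ (cong (_* w i y) (insertAt-lookup e i (- Λ)))
                     (sum-cong s (λ k → cong (_* w (punchIn i k) y) (insertAt-punchIn e i (- Λ) k))) ⟩
      - Λ * w i y + sum s (λ k → e k * w (punchIn i k) y) ≡⟨ +-comm _ _ ⟩
      sum s (λ k → e k * w (punchIn i k) y) + - Λ * w i y ≡⟨ cong (_ +_) shift ⟩
      sum s (λ k → e k * w (punchIn i k) y) + sum s (λ k → e k * - (a k * w i y)) ≡⟨ sum-distrib-+ s _ _ ⟨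
      sum s (λ k → e k * w (punchIn i k) y + e k * - (a k * w i y)) ≡⟨ sum-cong s (λ k → distribˡ _ _ _) ⟨
      lincomb e (λ k y → w (punchIn i k) y + - (a k * w i y)) y ≡⟨ ≗0 y ⟩
      0#                                              ∎
      where
      shift : - Λ * w i y ≡ sum s (λ k → e k * - (a k * w i y))
      shift = begin
        - Λ * w i y                               ≡⟨ -‿distribˡ-* Λ (w i y) ⟨
        - (Λ * w i y)                             ≡⟨ cong -_ (*-distribʳ-sum s (w i y) _) ⟩
        - sum s (λ k → (e k * a k) * w i y)       ≡⟨ -‿distrib-sum s _ ⟩
        sum s (λ k → - ((e k * a k) * w i y))
          ≡⟨ sum-cong s (λ k → trans (cong -_ (*-assoc _ _ _)) (-‿distribʳ-* _ _)) ⟩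
        sum s (λ k → e k * - (a k * w i y))       ∎

  shear-∈⟨tail⟩ : ∀ {t n} {v : Fin (suc t) → Vector n} {x y} a (x∈ : x ∈⟨ v ⟩) (y∈ : y ∈⟨ v ⟩) →
    a * proj₁ y∈ zero ≡ proj₁ x∈ zero → (λ i → x i + - (a * y i)) ∈⟨ v ∘ suc ⟩
  shear-∈⟨tail⟩ {v = v} {x} {y} a (c , x≗) (d , y≗) ad₀≡c₀ =
    ∈⟨⟩-tail {vs = v} (λ j → c j + - (a * d j)) combination head≡0
    where
    combination : (λ i → x i + - (a * y i)) ≗ lincomb (λ j → c j + - (a * d j)) v
    combination i = trans (cong₂ (λ s t → s + - (a * t)) (x≗ i) (y≗ i)) (sym (lincomb-+-* c d a v i))
    head≡0 : c zero + - (a * d zero) ≡ 0#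
    head≡0 = trans (cong (λ t → c zero + - t) ad₀≡c₀) (-‿inverseʳ (c zero))

  -- Pivot on some w i with a nonzero coefficient on v zero; shearing the other w's by multiples of w i
  -- kills their v zero components, leaving s independent vectors in the span of the other t vectors.
  exchange : ∀ t {s n} (w : Fin s → Vector n) (v : Fin t → Vector n) → LinIndep w → w ⊆⟨ v ⟩ → s ℕ.≤ t
  exchange zero    {zero}  w v w-indep w⊆v = z≤n
  exchange zero    {suc s} w v w-indep w⊆v = ⊥-elim (independent⇒nonzero w w-indep zero (proj₂ (w⊆v zero)))
  exchange (suc t) {zero}  w v w-indep w⊆v = z≤n
  exchange (suc t) {suc s} w v w-indep w⊆v with Finₚ.any? (λ i → ¬? (proj₁ (w⊆v i) zero ≟ 0#))
  ... | no ¬∃nonzero = ℕₚ.m≤n⇒m≤1+n (exchange t w (v ∘ suc) w-indep λ i →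
          ∈⟨⟩-tail {vs = v} (proj₁ (w⊆v i)) (proj₂ (w⊆v i))
                   (decidable-stable (_ ≟ 0#) (λ ≢0 → ¬∃nonzero (i , ≢0))))
  ... | yes (i , headᵢ≢0) = s≤s (exchange t _ (v ∘ suc) (shear-independent w w-indep i a) λ k →
          shear-∈⟨tail⟩ {v = v} (a k) (w⊆v (punchIn i k)) (w⊆v i) (a-scales k))
    where
    head : Fin (suc s) → Carrier
    head i = proj₁ (w⊆v i) zero
    β : Carrier
    β = proj₁ (inverse (head i) headᵢ≢0)
    a : Fin s → Carrier
    a k = head (punchIn i k) * β
    a-scales : ∀ k → a k * head i ≡ head (punchIn i k)
    a-scales k = begin
      (head (punchIn i k) * β) * head i ≡⟨ *-assoc _ _ _ ⟩
      head (punchIn i k) * (β * head i)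
        ≡⟨ cong (head (punchIn i k) *_) (trans (*-comm _ _) (proj₂ (inverse (head i) headᵢ≢0))) ⟩
      head (punchIn i k) * 1#           ≡⟨ *-identityʳ _ ⟩
      head (punchIn i k)                ∎

  independent-subfamily : ∀ {m r n} → r ℕ.≤ m → (v : Fin m → Vector n) → LinIndep v →
    Σ (Fin r → Fin m) λ h → LinIndep (v ∘ h)
  independent-subfamily {zero}  z≤n v v-indep = (λ ()) , (λ c ≗0 ())
  independent-subfamily {suc m} r≤ v v-indep with ℕₚ.m≤n⇒m<n∨m≡n r≤
  ... | inj₂ refl = (λ j → j) , v-indep
  ... | inj₁ (s≤s r≤m) with independent-subfamily r≤m (v ∘ suc) (independent-tail v v-indep)
  ...   | h , vh-indep = suc ∘ h , vh-indep

  basis-of-family : ∀ {s n} (v : Fin s → Vector n) →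
    Σ ℕ λ m → Σ (Fin m → Fin s) λ g → LinIndep (v ∘ g) × v ⊆⟨ v ∘ g ⟩
  basis-of-family {zero}  v = 0 , (λ ()) , (λ c ≗0 ()) , (λ ())
  basis-of-family {suc s} v with basis-of-family (v ∘ suc)
  ... | m , g , vg-indep , v⊆vg with v zero ∈⟨ v ∘ suc ∘ g ⟩?
  ...   | yes v₀∈ = m , suc ∘ g , vg-indep , λ { zero → v₀∈ ; (suc j) → v⊆vg j }
  ...   | no  v₀∉ = suc m , zero ∷ suc ∘ g , vg′-indep , v⊆vg′
    where
    vg′-indep : LinIndep (v ∘ (zero ∷ suc ∘ g))
    vg′-indep = LinIndep-resp {vs = v zero ∷ v ∘ suc ∘ g} {ws = v ∘ (zero ∷ suc ∘ g)}
                  (λ { zero _ → refl ; (suc j) _ → refl }) (∷-independent (v zero) (v ∘ suc ∘ g) vg-indep v₀∉)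
    v⊆vg′ : v ⊆⟨ v ∘ (zero ∷ suc ∘ g) ⟩
    v⊆vg′ zero    = ∈⟨⟩-member (v ∘ (zero ∷ suc ∘ g)) zero
    v⊆vg′ (suc j) = ∈⟨⟩-trans {vs = v ∘ suc ∘ g} {ws = v ∘ (zero ∷ suc ∘ g)}
                      (λ l → ∈⟨⟩-member (v ∘ (zero ∷ suc ∘ g)) (suc l)) (v⊆vg j)

  independent⇒≤dim : ∀ {s n} (w : Fin s → Vector n) → LinIndep w → s ℕ.≤ n
  independent⇒≤dim {n = n} w w-indep = exchange n w δ w-indep (λ i → w i , δ-expansion (w i))

  independent⇒spanning : ∀ {n} (w : Fin n → Vector n) → LinIndep w → ∀ x → x ∈⟨ w ⟩
  independent⇒spanning w w-indep x with x ∈⟨ w ⟩?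
  ... | yes x∈ = x∈
  ... | no  x∉ = ⊥-elim (ℕₚ.1+n≰n (independent⇒≤dim (x ∷ w) (∷-independent x w w-indep x∉)))

  spanning⇒independent : ∀ {n m} (G w : Fin n → Vector m) → LinIndep w → w ⊆⟨ G ⟩ → LinIndep G
  spanning⇒independent G w w-indep w⊆G with independent-or-dependent G
  ... | inj₁ G-indep = G-indep
  spanning⇒independent {suc n} G w w-indep w⊆G | inj₂ (c , ≗0 , i , cᵢ≢0) =
    ⊥-elim (ℕₚ.1+n≰n (exchange n w (removeAt G i) w-indep (λ j → ∈⟨⟩-trans G⊆G∖i (w⊆G j))))
    where
    G⊆G∖i : G ⊆⟨ removeAt G i ⟩
    G⊆G∖i j with i Finₚ.≟ j
    ... | yes refl = dependent⇒∈⟨removeAt⟩ G c ≗0 i cᵢ≢0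
    ... | no  i≢j  = ∈⟨⟩-resp (λ y → cong (λ v → v y) (removeAt-punchOut G i≢j))
                                (∈⟨⟩-member (removeAt G i) (punchOut i≢j))

  ∃-basis : ∀ {n} (P : Vector n → Set) → (∀ {x y} → x ≗ y → P x → P y) → (∀ x → Dec (P x)) → ∃ (HasDim P)
  ∃-basis {n} P P-resp P? = grow (suc n) {0} (λ ()) (λ ()) (λ c ≗0 ()) (ℕₚ.n<1+n n)
    where
    grow : ∀ fuel {m} (D : Fin m → Vector n) → (∀ j → P (D j)) → LinIndep D → n ℕ.< m ℕ.+ fuel → ∃ (HasDim P)
    grow zero       D D⊆P D-indep n<m+0 =
      ⊥-elim (ℕₚ.<⇒≱ (subst (n ℕ.<_) (ℕₚ.+-identityʳ _) n<m+0) (independent⇒≤dim D D-indep))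
    grow (suc fuel) D D⊆P D-indep n<m+fuel with ∃-vector? n (λ x → P x × ¬ x ∈⟨ D ⟩) ext
                                                         (λ x → P? x ×-dec ¬? (x ∈⟨ D ⟩?))
      where
      ext : Extensional (λ x → P x × ¬ x ∈⟨ D ⟩)
      ext x≗y (Px , x∉) = P-resp x≗y Px , x∉ ∘ ∈⟨⟩-resp (sym ∘ x≗y)
    ... | yes (x , Px , x∉) = grow fuel (x ∷ D) (λ { zero → Px ; (suc j) → D⊆P j }) (∷-independent x D D-indep x∉)
                                (subst (n ℕ.<_) (ℕₚ.+-suc _ fuel) n<m+fuel)
    ... | no  ∄ = _ , D , D⊆P , D-indep , λ x Px → decidable-stable (x ∈⟨ D ⟩?) (λ x∉ → ∄ (x , Px , x∉))

module Rank (F : Field) {q : ℕ} (enumeration : Fin q ↔ Field.Carrier F) where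
  open Field F
  open LinearAlgebra F
  open Sums F
  open Spans F
  open Dimension F enumeration
  open ≡-Reasoning

  transpose : ∀ {a b} → Matrix a b → Matrix b a
  transpose M i j = M j i

  rankAtLeast-resp : ∀ {a b r} {M N : Matrix a b} → (∀ x y → M x y ≡ N x y) → RankAtLeast M r → RankAtLeast N r
  rankAtLeast-resp M≡N (f , indep) = f , LinIndep-resp (λ j x → M≡N x (f j)) indep

  rankAtLeast-≤ : ∀ {a b r s} (M : Matrix a b) → RankAtLeast M r → s ℕ.≤ r → RankAtLeast M s
  rankAtLeast-≤ M (f , indep) s≤r with independent-subfamily s≤r (column M ∘ f) indep
  ... | h , indep′ = f ∘ h , indep′

  rankAtLeast-from-span : ∀ {a b r} (M : Matrix a b) (w : Fin r → Vector a) → LinIndep w →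
    w ⊆⟨ column M ⟩ → RankAtLeast M r
  rankAtLeast-from-span M w w-indep w⊆M with basis-of-family (column M)
  ... | m , g , Mg-indep , M⊆Mg =
    rankAtLeast-≤ M (g , Mg-indep) (exchange m w (column M ∘ g) w-indep (λ i → ∈⟨⟩-trans M⊆Mg (w⊆M i)))

  zero-rank : ∀ {a b r} (M : Matrix a b) → (∀ i j → M i j ≡ 0#) → ¬ RankAtLeast M (suc r)
  zero-rank M M≡0 (f , indep) = independent⇒nonzero (column M ∘ f) indep zero (λ x → M≡0 x (f zero))

  rankAtLeast-submatrix : ∀ {a b a′ b′ r} (M : Matrix a b) (h : Fin a′ → Fin a) (k : Fin b′ → Fin b) →
    RankAtLeast (λ x y → M (h x) (k y)) r → RankAtLeast M r
  rankAtLeast-submatrix M h k (f , indep) = k ∘ f , λ c ≗0 → indep c (λ x → ≗0 (h x))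

  -- Restricted to a basis of the rows, the r independent columns stay independent,
  -- so that basis has at least r members.
  rankAtLeast-transpose : ∀ {a b r} (M : Matrix a b) → RankAtLeast M r → RankAtLeast (transpose M) r
  rankAtLeast-transpose {a} {r = r} M (f , cols-indep) with basis-of-family rows
    where
    rows : Fin a → Vector r
    rows i j = M i (f j)
  ... | m , g , basis-indep , rows⊆basis with independent-subfamily (independent⇒≤dim κ κ-indep) _ basis-indep
    where
    κ : Fin r → Vector m
    κ j k = M (g k) (f j)
    κ-indep : LinIndep κ
    κ-indep c ≗0 = cols-indep c λ i → begin
      sum r (λ j → c j * M i (f j))
        ≡⟨ sum-cong r (λ j → cong (c j *_) (proj₂ (rows⊆basis i) j)) ⟩
      sum r (λ j → c j * sum m (λ k → coeff i k * M (g k) (f j)))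
        ≡⟨ sum-cong r (λ j → *-distribˡ-sum m (c j) _) ⟩
      sum r (λ j → sum m (λ k → c j * (coeff i k * M (g k) (f j)))) ≡⟨ sum-comm r m _ ⟩
      sum m (λ k → sum r (λ j → c j * (coeff i k * M (g k) (f j))))
        ≡⟨ sum-cong m (λ k → trans (sum-cong r (λ j → *-leftComm _ _ _)) (sym (*-distribˡ-sum r _ _))) ⟩
      sum m (λ k → coeff i k * lincomb c κ k) ≡⟨ sum-zero m (λ k → trans (cong (coeff i k *_) (≗0 k)) (zeroʳ _)) ⟩
      0# ∎
      where
      coeff : Fin a → Fin m → Carrier
      coeff i = proj₁ (rows⊆basis i)
  ... | h , independent-rows = g ∘ h , λ c ≗0 → independent-rows c (λ j → ≗0 (f j))

  rankAtLeast-dropColumns : ∀ {n b K r} (M : Matrix n (b ℕ.+ K)) → RankAtLeast M (r ℕ.+ K) →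
    RankAtLeast (λ x y → M x (y ↑ˡ K)) r
  rankAtLeast-dropColumns {n} {b} {K} {r} M (f , indep) with basis-of-family (column (λ x y → M x (y ↑ˡ K)))
  ... | m , g , Mg-indep , M⊆Mg = rankAtLeast-≤ (λ x y → M x (y ↑ˡ K)) (g , Mg-indep) (ℕₚ.+-cancelʳ-≤ K r m r+K≤m+K)
    where
    G : Fin (m ℕ.+ K) → Vector n
    G = (λ j → column M (g j ↑ˡ K)) ++ (λ j → column M (b ↑ʳ j))
    M⊆G : column M ⊆⟨ G ⟩
    M⊆G y with Fin.splitAt b y in eq
    ... | inj₁ j = ∈⟨⟩-resp (λ x → cong (M x) (Finₚ.splitAt⁻¹-↑ˡ eq)) (∈⟨⟩-++ˡ _ (M⊆Mg j))
    ... | inj₂ j = ∈⟨⟩-resp (λ x → cong (M x) (Finₚ.splitAt⁻¹-↑ʳ eq)) (∈⟨⟩-++ʳ _ (∈⟨⟩-member _ j))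
    r+K≤m+K : r ℕ.+ K ℕ.≤ m ℕ.+ K
    r+K≤m+K = exchange (m ℕ.+ K) (column M ∘ f) G indep (M⊆G ∘ f)

  rankAtLeast-dropRows : ∀ {a K b r} (M : Matrix (a ℕ.+ K) b) → RankAtLeast M (r ℕ.+ K) →
    RankAtLeast (λ x y → M (x ↑ˡ K) y) r
  rankAtLeast-dropRows {K = K} M rk =
    rankAtLeast-transpose (λ y x → M (x ↑ˡ K) y) (rankAtLeast-dropColumns (transpose M) (rankAtLeast-transpose M rk))

  ⊆⟨⟩⇒rankAtMost : ∀ {a b u} (M : Matrix a b) (vs : Fin u → Vector a) → column M ⊆⟨ vs ⟩ → RankAtMost M u
  ⊆⟨⟩⇒rankAtMost M vs M⊆vs (f , indep) = ℕₚ.1+n≰n (exchange _ (column M ∘ f) vs indep (M⊆vs ∘ f))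

  rankAtMost⇒≤ : ∀ {a b u m} (M : Matrix a b) → RankAtMost M u →
    (g : Fin m → Fin b) → LinIndep (column M ∘ g) → m ℕ.≤ u
  rankAtMost⇒≤ M M≤u g indep = ℕₚ.≮⇒≥ (λ u<m → M≤u (rankAtLeast-≤ M (g , indep) u<m))

  rankAtLeast-difference : ∀ {a b r s} (M N : Matrix a b) → RankAtLeast (M -M N) (r ℕ.+ s) → RankAtMost N s → RankAtLeast M r
  rankAtLeast-difference {r = r} {s} M N (f , indep) N≤s with basis-of-family (column M) | basis-of-family (column N)
  ... | m , g , Mg-indep , M⊆Mg | m′ , g′ , Ng′-indep , N⊆Ng′ = rankAtLeast-≤ M (g , Mg-indep) r≤m
    where
    r+s≤m+m′ : r ℕ.+ s ℕ.≤ m ℕ.+ m′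
    r+s≤m+m′ = exchange (m ℕ.+ m′) (column (M -M N) ∘ f) ((column M ∘ g) ++ (column N ∘ g′)) indep
                 (λ i → ∈⟨⟩-difference (M⊆Mg (f i)) (N⊆Ng′ (f i)))
    r≤m : r ℕ.≤ m
    r≤m = ℕₚ.+-cancelʳ-≤ s r m (ℕₚ.≤-trans r+s≤m+m′ (ℕₚ.+-monoʳ-≤ m (rankAtMost⇒≤ N N≤s g′ Ng′-indep)))

  rank-basis : ∀ {a b u} (M : Matrix a b) → RankAtLeast M u → RankAtMost M u →
    Σ (Fin u → Vector a) λ B → LinIndep B × column M ⊆⟨ B ⟩
  rank-basis M (f , indep) M≤u = column M ∘ f , indep , λ y →
    decidable-stable (column M y ∈⟨ column M ∘ f ⟩?) λ y∉ →
      M≤u (y ∷ f , LinIndep-resp {vs = column M y ∷ column M ∘ f} {ws = column M ∘ (y ∷ f)}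
                     (λ { zero _ → refl ; (suc j) _ → refl })
                     (∷-independent (column M y) (column M ∘ f) indep y∉))

  columns : ∀ {m n} → (Fin m → Vector n) → Matrix n m
  columns vs x j = vs j x

  -- P *ᵀ Q is the product P Qᵀ.
  _*ᵀ_ : ∀ {n m p} → Matrix n m → Matrix p m → Matrix n p
  (P *ᵀ Q) x y = lincomb (Q y) (column P) x

  *ᵀ-rankAtMost : ∀ {n m p} (P : Matrix n m) (Q : Matrix p m) → RankAtMost (P *ᵀ Q) m
  *ᵀ-rankAtMost P Q = ⊆⟨⟩⇒rankAtMost (P *ᵀ Q) (column P) (λ y → Q y , λ _ → refl)

  *ᵀ-rankAtLeast : ∀ {n m p} (P : Matrix n m) (Q : Matrix p m) →
    LinIndep (column P) → LinIndep (column Q) → RankAtLeast (P *ᵀ Q) m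
  *ᵀ-rankAtLeast P Q P-indep Q-indep = rankAtLeast-from-span (P *ᵀ Q) (column P) P-indep P⊆PQ
    where
    δ∈rows : ∀ j → δ j ∈⟨ column (transpose Q) ⟩
    δ∈rows j with rankAtLeast-transpose Q ((λ j → j) , Q-indep)
    ... | f , rows-indep = ∈⟨⟩-trans (λ k → ∈⟨⟩-member _ (f k)) (independent⇒spanning _ rows-indep (δ j))
    P⊆PQ : column P ⊆⟨ column (P *ᵀ Q) ⟩
    P⊆PQ j = proj₁ (δ∈rows j) , λ x → begin
      column P j x                                      ≡⟨ lincomb-δ j (column P) x ⟨
      lincomb (δ j) (column P) x                        ≡⟨ lincomb-congˡ (column P) (proj₂ (δ∈rows j)) x ⟩
      lincomb (lincomb (proj₁ (δ∈rows j)) Q) (column P) x ≡⟨ lincomb-lincomb _ Q (column P) x ⟨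
      lincomb (proj₁ (δ∈rows j)) (column (P *ᵀ Q)) x    ∎

module Puncturing (F : Field) {q : ℕ} (enumeration : Fin q ↔ Field.Carrier F) where
  open Field F
  open LinearAlgebra F
  open Sums F using (-‿inverseʳ)
  open Rank F enumeration

  distance⇒distinct : ∀ {a b d N} (C : Fin N → Matrix a b) → 1 ℕ.≤ d →
    (∀ k l → k ≢ l → RankAtLeast (C k -M C l) d) → ∀ k l → (∀ i j → C k i j ≡ C l i j) → k ≡ l
  distance⇒distinct C (s≤s z≤n) distance k l Cₖ≡Cₗ with k Finₚ.≟ l
  ... | yes k≡l = k≡l
  ... | no  k≢l = ⊥-elim (zero-rank (C k -M C l) (λ x y → trans (cong (_+ - C l x y) (Cₖ≡Cₗ x y)) (-‿inverseʳ _))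
                                    (distance k l k≢l))

  ΛLe-puncture : ∀ a b d u i D → 1 ℕ.≤ d → d ℕ.+ i ℕ.≤ D →
    ΛLe (a ℕ.+ i) (b ℕ.+ (D ℕ.∸ (d ℕ.+ i))) D u a b d u
  ΛLe-puncture a b d u i D 1≤d d+i≤D N (C , _ , rank≤u , distance) =
    C′ , distance⇒distinct C′ 1≤d distance′ , rank′≤u , distance′
    where
    K : ℕ
    K = D ℕ.∸ (d ℕ.+ i)
    C′ : Fin N → Matrix a b
    C′ k x y = C k (x ↑ˡ i) (y ↑ˡ K)
    rank′≤u : ∀ k → RankAtMost (C′ k) u
    rank′≤u k = rank≤u k ∘ rankAtLeast-submatrix (C k) (_↑ˡ i) (_↑ˡ K)
    distance′ : ∀ k l → k ≢ l → RankAtLeast (C′ k -M C′ l) d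
    distance′ k l k≢l =
      rankAtLeast-dropRows (λ x y → (C k -M C l) x (y ↑ˡ K)) (rankAtLeast-dropColumns (C k -M C l)
        (subst (RankAtLeast (C k -M C l)) (sym (ℕₚ.m+[n∸m]≡n d+i≤D)) (distance k l k≢l)))

module PartialSpreads (F : Field) {q : ℕ} (enumeration : Fin q ↔ Field.Carrier F) where
  open Field F
  open LinearAlgebra F
  open Sums F
  open Spans F
  open Dimension F enumeration
  open Rank F enumeration
  open Puncturing F enumeration using (distance⇒distinct)
  open ≡-Reasoning

  -- N u-dimensional subspaces of F^v, given by bases, any two of which intersect trivially.
  PartialSpread : ℕ → ℕ → ℕ → Set
  PartialSpread u v N = Σ (Fin N → Fin u → Vector v) λ B →
    (∀ k → LinIndep (B k)) × (∀ k l → k ≢ l → LinIndep (B k ++ B l))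

  ++-independent⇒disjoint : ∀ {m k n} (xs : Fin m → Vector n) (ys : Fin k → Vector n) → LinIndep (xs ++ ys) →
    ∀ {x} → x ∈⟨ xs ⟩ → x ∈⟨ ys ⟩ → x ≗ zeroV
  ++-independent⇒disjoint {k = k} xs ys indep {x} (c , x≗) x∈ys i = begin
    x i             ≡⟨ x≗ i ⟩
    lincomb c xs i  ≡⟨ lincomb-congˡ xs c≡0 i ⟩
    lincomb (λ _ → 0#) xs i ≡⟨ lincomb-zero xs i ⟩
    0#              ∎
    where
    x-x∈ : (λ i → x i + - x i) ∈⟨ xs ++ ys ⟩
    x-x∈ = ∈⟨⟩-difference (c , x≗) x∈ys
    c≡0 : ∀ j → c j ≡ 0#
    c≡0 j = trans (sym (lookup-++ˡ c _ j))
              (indep (proj₁ x-x∈) (λ i → trans (sym (proj₂ x-x∈ i)) (-‿inverseʳ (x i))) (j ↑ˡ k))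

  ++-independent : ∀ {m k n} (xs : Fin m → Vector n) (ys : Fin k → Vector n) → LinIndep xs → LinIndep ys →
    (∀ {x} → x ∈⟨ xs ⟩ → x ∈⟨ ys ⟩ → x ≗ zeroV) → LinIndep (xs ++ ys)
  ++-independent {m} {k} xs ys xs-indep ys-indep disjoint c ≗0 J =
    trans (sym (splitAt-++ m c J)) (++⁺ (_≡ 0#) (xs-indep cˡ x≗0) (ys-indep cʳ y≗0) J)
    where
    cˡ : Fin m → Carrier
    cˡ j = c (j ↑ˡ k)
    cʳ : Fin k → Carrier
    cʳ j = c (m ↑ʳ j)
    x+y≗0 : ∀ i → lincomb cˡ xs i + lincomb cʳ ys i ≡ 0#
    x+y≗0 i = trans (sym (lincomb-++ cˡ cʳ xs ys i)) (trans (lincomb-congˡ (xs ++ ys) (splitAt-++ m c) i) (≗0 i))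
    -y∈xs : (λ i → - lincomb cʳ ys i) ∈⟨ xs ⟩
    -y∈xs = cˡ , λ i → sym (+-inverseˡ-unique _ _ (x+y≗0 i))
    -y∈ys : (λ i → - lincomb cʳ ys i) ∈⟨ ys ⟩
    -y∈ys = (λ j → - cʳ j) , λ i → sym (lincomb-neg cʳ ys i)
    y≗0 : lincomb cʳ ys ≗ zeroV
    y≗0 i = trans (sym (-‿involutive _)) (trans (cong -_ (disjoint -y∈xs -y∈ys i)) -0#≈0#)
    x≗0 : lincomb cˡ xs ≗ zeroV
    x≗0 i = trans (+-inverseˡ-unique _ _ (x+y≗0 i)) (trans (cong -_ (y≗0 i)) -0#≈0#)

  ++-negʳ-independent : ∀ {m k n} (xs : Fin m → Vector n) (ys : Fin k → Vector n) →
    LinIndep (xs ++ ys) → LinIndep (xs ++ (λ j i → - ys j i))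
  ++-negʳ-independent xs ys indep = spanning⇒independent _ (xs ++ ys) indep
    (++⁺ (_∈⟨ _ ⟩) (∈⟨⟩-++ˡ _ ∘ ∈⟨⟩-member xs) (∈⟨⟩-++ʳ xs ∘ ys∈⟨-ys⟩))
    where
    ys∈⟨-ys⟩ : ys ⊆⟨ (λ j i → - ys j i) ⟩
    ys∈⟨-ys⟩ j = ∈⟨⟩-resp (λ i → trans (-1*x≈-x _) (-‿involutive _))
                          (∈-scale ⟨ (λ j i → - ys j i) ⟩ (- 1#) (∈⟨⟩-member _ j))

  pad : ∀ {v n} → v ℕ.≤ n → Vector v → Vector n
  pad z≤n     x i       = 0#
  pad (s≤s p) x zero    = x zero
  pad (s≤s p) x (suc i) = pad p (x ∘ suc) i

  pad-inject≤ : ∀ {v n} (p : v ℕ.≤ n) (x : Vector v) i → pad p x (Fin.inject≤ i p) ≡ x i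
  pad-inject≤ (s≤s p) x zero    = refl
  pad-inject≤ (s≤s p) x (suc i) = pad-inject≤ p (x ∘ suc) i

  lincomb-pad : ∀ {k v n} (p : v ℕ.≤ n) (c : Fin k → Carrier) (vs : Fin k → Vector v) →
    lincomb c (pad p ∘ vs) ≗ pad p (lincomb c vs)
  lincomb-pad {k} z≤n     c vs i       = sum-zero k (λ j → zeroʳ _)
  lincomb-pad     (s≤s p) c vs zero    = refl
  lincomb-pad     (s≤s p) c vs (suc i) = lincomb-pad p c (λ j → vs j ∘ suc) i

  pad-independent : ∀ {k v n} (p : v ℕ.≤ n) (vs : Fin k → Vector v) → LinIndep vs → LinIndep (pad p ∘ vs)
  pad-independent p vs indep c ≗0 = indep c λ i →
    trans (sym (pad-inject≤ p (lincomb c vs) i)) (trans (sym (lincomb-pad p c vs (Fin.inject≤ i p))) (≗0 _))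

  partialSpread-pad : ∀ {u v n N} → v ℕ.≤ n → PartialSpread u v N → PartialSpread u n N
  partialSpread-pad p (B , B-indep , B-pairs) =
    (λ k → pad p ∘ B k) , (λ k → pad-independent p (B k) (B-indep k)) , λ k l k≢l →
      LinIndep-resp (λ J i → cong (λ v → v i) (++-map (pad p) (B k) (B l) J))
                    (pad-independent p (B k ++ B l) (B-pairs k l k≢l))

  partialSpread⇒code : ∀ {u v a b N} → 1 ℕ.≤ u → v ℕ.≤ a → v ℕ.≤ b →
    PartialSpread u v N → RankMetricCode a b (2 ℕ.* u) u N
  partialSpread⇒code {u} {v} {a} {b} {N} 1≤u v≤a v≤b (B , B-indep , B-pairs) =
    X , distance⇒distinct X (ℕₚ.≤-trans 1≤u (ℕₚ.m≤m+n u _)) distance , rank≤u , distance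
    where
    X : Fin N → Matrix a b
    X k = columns (pad v≤a ∘ B k) *ᵀ columns (pad v≤b ∘ B k)
    rank≤u : ∀ k → RankAtMost (X k) u
    rank≤u k = *ᵀ-rankAtMost (columns (pad v≤a ∘ B k)) (columns (pad v≤b ∘ B k))
    distance : ∀ k l → k ≢ l → RankAtLeast (X k -M X l) (2 ℕ.* u)
    distance k l k≢l = subst (RankAtLeast (X k -M X l)) (u+u≡2*u u)
      (rankAtLeast-resp X-difference (*ᵀ-rankAtLeast (columns Ps) (columns Qs) Ps-indep Qs-indep))
      where
      Ps : Fin (u ℕ.+ u) → Vector a
      Ps = (pad v≤a ∘ B k) ++ (pad v≤a ∘ B l)
      Qs : Fin (u ℕ.+ u) → Vector b
      Qs = (pad v≤b ∘ B k) ++ (λ j y → - pad v≤b (B l j) y)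
      Bₖ++Bₗ-padded-indep : ∀ {n} (p : v ℕ.≤ n) → LinIndep ((pad p ∘ B k) ++ (pad p ∘ B l))
      Bₖ++Bₗ-padded-indep p = LinIndep-resp (λ J i → cong (λ w → w i) (++-map (pad p) (B k) (B l) J))
                                            (pad-independent p (B k ++ B l) (B-pairs k l k≢l))
      Ps-indep : LinIndep Ps
      Ps-indep = Bₖ++Bₗ-padded-indep v≤a
      Qs-indep : LinIndep Qs
      Qs-indep = ++-negʳ-independent (pad v≤b ∘ B k) (pad v≤b ∘ B l) (Bₖ++Bₗ-padded-indep v≤b)
      X-difference : ∀ x y → (columns Ps *ᵀ columns Qs) x y ≡ (X k -M X l) x y
      X-difference x y = begin
        lincomb (λ J → Qs J y) Ps x
          ≡⟨ lincomb-congˡ Ps (++-map (λ w → w y) (pad v≤b ∘ B k) _) x ⟩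
        lincomb ((λ j → pad v≤b (B k j) y) ++ (λ j → - pad v≤b (B l j) y)) Ps x
          ≡⟨ lincomb-++ _ _ (pad v≤a ∘ B k) (pad v≤a ∘ B l) x ⟩
        X k x y + lincomb (λ j → - pad v≤b (B l j) y) (pad v≤a ∘ B l) x
          ≡⟨ cong (X k x y +_) (lincomb-neg _ (pad v≤a ∘ B l) x) ⟩
        X k x y + - X l x y ∎

  code-transpose : ∀ {a b d u N} → RankMetricCode a b d u N → RankMetricCode b a d u N
  code-transpose (C , C-injective , C≤u , distance) =
    (λ k → transpose (C k)) , (λ k l Cₖ≡Cₗ → C-injective k l (λ i j → Cₖ≡Cₗ j i)) ,
    (λ k → C≤u k ∘ rankAtLeast-transpose (transpose (C k))) ,
    (λ k l k≢l → rankAtLeast-transpose (C k -M C l) (distance k l k≢l))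

  code⇒partialSpread : ∀ {u a b N} → RankMetricCode a b (2 ℕ.* u) u N → (N ≡ 1 → u ℕ.≤ a) → PartialSpread u a N
  code⇒partialSpread {N = zero} code u≤a = (λ ()) , (λ ()) , (λ ())
  code⇒partialSpread {N = suc zero} code u≤a with independent-subfamily (u≤a refl) δ δ-independent
  ... | h , δh-indep = (λ _ → δ ∘ h) , (λ _ → δh-indep) , λ { zero zero 0≢0 → ⊥-elim (0≢0 refl) }
  code⇒partialSpread {u} {a} {b} {N = suc (suc n)} (C , _ , C≤u , distance) _ = B , B-indep , B-pairs
    where
    distance′ : ∀ k l → k ≢ l → RankAtLeast (C k -M C l) (u ℕ.+ u)
    distance′ k l k≢l = subst (RankAtLeast (C k -M C l)) (sym (u+u≡2*u u)) (distance k l k≢l)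
    C≥u : ∀ k → RankAtLeast (C k) u
    C≥u k = rankAtLeast-difference (C k) (C (punchIn k zero)) (distance′ k _ (≢-sym (Finₚ.punchInᵢ≢i k zero))) (C≤u _)
    basis : ∀ k → Σ (Fin u → Vector a) λ B → LinIndep B × column (C k) ⊆⟨ B ⟩
    basis k = rank-basis (C k) (C≥u k) (C≤u k)
    B : Fin (suc (suc n)) → Fin u → Vector a
    B k = proj₁ (basis k)
    B-indep : ∀ k → LinIndep (B k)
    B-indep k = proj₁ (proj₂ (basis k))
    B-pairs : ∀ k l → k ≢ l → LinIndep (B k ++ B l)
    B-pairs k l k≢l = spanning⇒independent (B k ++ B l) (column (C k -M C l) ∘ f) indep
      (λ i → ∈⟨⟩-difference (proj₂ (proj₂ (basis k)) (f i)) (proj₂ (proj₂ (basis l)) (f i)))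
      where
      f : Fin (u ℕ.+ u) → Fin b
      f = proj₁ (distance′ k l k≢l)
      indep : LinIndep (column (C k -M C l) ∘ f)
      indep = proj₂ (distance′ k l k≢l)

  code⇒partialSpread⊓ : ∀ {u a b N} → RankMetricCode a b (2 ℕ.* u) u N → (N ≡ 1 → u ℕ.≤ a ℕ.⊓ b) →
    PartialSpread u (a ℕ.⊓ b) N
  code⇒partialSpread⊓ {u} {a} {b} {N} code u≤a⊓b with ℕₚ.⊓-sel a b
  ... | inj₁ a⊓b≡a = subst (λ v → PartialSpread u v N) (sym a⊓b≡a)
                       (code⇒partialSpread code (subst (u ℕ.≤_) a⊓b≡a ∘ u≤a⊓b))
  ... | inj₂ a⊓b≡b = subst (λ v → PartialSpread u v N) (sym a⊓b≡b)
                       (code⇒partialSpread (code-transpose code) (subst (u ℕ.≤_) a⊓b≡b ∘ u≤a⊓b))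

  partialSpread⇒constantDimCode : ∀ {u v N} → 1 ℕ.≤ u → PartialSpread u v N → ConstantDimCode v (2 ℕ.* u) u N
  partialSpread⇒constantDimCode {u} (s≤s z≤n) (B , B-indep , B-pairs) =
    (λ k → ⟨ B k ⟩) , (λ k → B k , ∈⟨⟩-member (B k) , B-indep k , λ x x∈ → x∈) , distinct , distance
    where
    distinct : ∀ k l → SameSubspace ⟨ B k ⟩ ⟨ B l ⟩ → k ≡ l
    distinct k l same with k Finₚ.≟ l
    ... | yes k≡l = k≡l
    ... | no  k≢l = ⊥-elim (independent⇒nonzero (B k) (B-indep k) zero
            (++-independent⇒disjoint (B k) (B l) (B-pairs k l k≢l) B₀∈ (Equivalence.to (same _) B₀∈)))
      where
      B₀∈ : B k zero ∈⟨ B k ⟩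
      B₀∈ = ∈⟨⟩-member (B k) zero
    distance : ∀ k l → k ≢ l → SubspaceDistAtLeast ⟨ B k ⟩ ⟨ B l ⟩ (2 ℕ.* u)
    distance k l k≢l s zero (D , _ , _ , D-spans) _ =
      subst (ℕ._≤ s) (trans (u+u≡2*u u) (sym (ℕₚ.+-identityʳ _)))
        (exchange s (B k ++ B l) D (B-pairs k l k≢l) (++⁺ (_∈⟨ D ⟩) Bₖ⊆D Bₗ⊆D))
      where
      Bₖ⊆D : B k ⊆⟨ D ⟩
      Bₖ⊆D j = D-spans (B k j) (B k j , zeroV , ∈⟨⟩-member (B k) j , ∈-zero ⟨ B l ⟩ , λ i → sym (+-identityʳ _))
      Bₗ⊆D : B l ⊆⟨ D ⟩
      Bₗ⊆D j = D-spans (B l j) (zeroV , B l j , ∈-zero ⟨ B k ⟩ , ∈⟨⟩-member (B l) j , λ i → sym (+-identityˡ _))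
    distance k l k≢l s (suc t) _ (E , E⊆ , E-indep , _) =
      ⊥-elim (independent⇒nonzero E E-indep zero
        (++-independent⇒disjoint (B k) (B l) (B-pairs k l k≢l) (proj₁ (E⊆ zero)) (proj₂ (E⊆ zero))))

  constantDimCode⇒partialSpread : ∀ {u v N} → ConstantDimCode v (2 ℕ.* u) u N → PartialSpread u v N
  constantDimCode⇒partialSpread {u} {v} {N} (C , dim , _ , distance) = B , B-indep , B-pairs
    where
    B : Fin N → Fin u → Vector v
    B k = proj₁ (dim k)
    B-indep : ∀ k → LinIndep (B k)
    B-indep k = proj₁ (proj₂ (proj₂ (dim k)))
    ∈C⇒∈⟨B⟩ : ∀ k {x} → mem (C k) x → x ∈⟨ B k ⟩
    ∈C⇒∈⟨B⟩ k = proj₂ (proj₂ (proj₂ (dim k))) _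
    ∈⟨B⟩⇒∈C : ∀ k {x} → x ∈⟨ B k ⟩ → mem (C k) x
    ∈⟨B⟩⇒∈C k (c , x≗) = ∈-resp (C k) (sym ∘ x≗) (lincomb∈ (C k) (proj₁ (proj₂ (dim k))) c)
    +S⇒∈⟨++⟩ : ∀ k l {x} → (C k +S C l) x → x ∈⟨ B k ++ B l ⟩
    +S⇒∈⟨++⟩ k l (y , z , y∈ , z∈ , x≗) = ∈⟨⟩-resp (sym ∘ x≗) (∈⟨⟩-++ (∈C⇒∈⟨B⟩ k y∈) (∈C⇒∈⟨B⟩ l z∈))
    ∈⟨++⟩⇒+S : ∀ k l {x} → x ∈⟨ B k ++ B l ⟩ → (C k +S C l) x
    ∈⟨++⟩⇒+S k l (c , x≗) =
      lincomb (λ j → c (j ↑ˡ u)) (B k) , lincomb (λ j → c (u ↑ʳ j)) (B l) ,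
      ∈⟨B⟩⇒∈C k (_ , λ _ → refl) , ∈⟨B⟩⇒∈C l (_ , λ _ → refl) ,
      λ i → trans (x≗ i) (trans (lincomb-congˡ (B k ++ B l) (sym ∘ splitAt-++ u c) i) (lincomb-++ _ _ (B k) (B l) i))
    +S-resp : ∀ k l {x y} → x ≗ y → (C k +S C l) x → (C k +S C l) y
    +S-resp k l x≗y (y′ , z′ , y′∈ , z′∈ , x≗) = y′ , z′ , y′∈ , z′∈ , λ i → trans (sym (x≗y i)) (x≗ i)
    ∩S-resp : ∀ k l {x y} → x ≗ y → (C k ∩S C l) x → (C k ∩S C l) y
    ∩S-resp k l x≗y (x∈Cₖ , x∈Cₗ) = ∈-resp (C k) x≗y x∈Cₖ , ∈-resp (C l) x≗y x∈Cₗ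
    mem? : ∀ k x → Dec (mem (C k) x)
    mem? k x = map′ (∈⟨B⟩⇒∈C k) (∈C⇒∈⟨B⟩ k) (x ∈⟨ B k ⟩?)
    disjoint : ∀ k l → k ≢ l → ∀ {x} → (C k ∩S C l) x → x ≗ zeroV
    disjoint k l k≢l {x} x∈
      with ∃-basis (C k +S C l) (+S-resp k l) (λ x → map′ (∈⟨++⟩⇒+S k l) (+S⇒∈⟨++⟩ k l) (x ∈⟨ B k ++ B l ⟩?))
         | ∃-basis (C k ∩S C l) (∩S-resp k l) (λ x → mem? k x ×-dec mem? l x)
    ... | _ , _ | zero , _ , _ , _ , E-spans = proj₂ (E-spans x x∈)
    ... | s , D-basis@(D , D⊆ , D-indep , _) | suc t , E-basis =
      ⊥-elim (ℕₚ.m+1+n≰m (2 ℕ.* u) (ℕₚ.≤-trans (distance k l k≢l s (suc t) D-basis E-basis)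
        (subst (s ℕ.≤_) (u+u≡2*u u) (exchange (u ℕ.+ u) D (B k ++ B l) D-indep (+S⇒∈⟨++⟩ k l ∘ D⊆)))))
    B-pairs : ∀ k l → k ≢ l → LinIndep (B k ++ B l)
    B-pairs k l k≢l = ++-independent (B k) (B l) (B-indep k) (B-indep l)
      (λ x∈Bₖ x∈Bₗ → disjoint k l k≢l (∈⟨B⟩⇒∈C k x∈Bₖ , ∈⟨B⟩⇒∈C l x∈Bₗ))

module SpreadBounds (F : Field) {q : ℕ} (enumeration : Fin q ↔ Field.Carrier F) where
  open Field F
  open LinearAlgebra F
  open Rank F enumeration using (zero-rank)
  open PartialSpreads F enumeration

  singleton-code : ∀ {a b d u} → RankMetricCode a b d u 1
  singleton-code = (λ _ _ _ → 0#) , (λ { zero zero _ → refl }) , (λ _ → zero-rank _ (λ _ _ → refl)) ,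
                   (λ { zero zero 0≢0 → ⊥-elim (0≢0 refl) })

  ΛLe-⊓-monotone : ∀ {a b a′ b′ u} → 1 ℕ.≤ u → a ℕ.⊓ b ℕ.≤ a′ ℕ.⊓ b′ →
    ΛLe a b (2 ℕ.* u) u a′ b′ (2 ℕ.* u) u
  ΛLe-⊓-monotone 1≤u ⊓≤⊓′ zero          _    = (λ ()) , (λ ()) , (λ ()) , (λ ())
  ΛLe-⊓-monotone 1≤u ⊓≤⊓′ (suc zero)    _    = singleton-code
  ΛLe-⊓-monotone 1≤u ⊓≤⊓′ (suc (suc n)) code = partialSpread⇒code 1≤u (ℕₚ.m⊓n≤m _ _) (ℕₚ.m⊓n≤n _ _)
    (partialSpread-pad ⊓≤⊓′ (code⇒partialSpread⊓ code (λ ())))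

  ΛEqA-⊓ : ∀ {a b u} → 1 ℕ.≤ u → u ℕ.≤ a → u ℕ.≤ b → ΛEqA a b (2 ℕ.* u) u (a ℕ.⊓ b) (2 ℕ.* u) u
  ΛEqA-⊓ 1≤u u≤a u≤b =
    (λ N code → partialSpread⇒constantDimCode 1≤u (code⇒partialSpread⊓ code (λ _ → ℕₚ.⊓-glb u≤a u≤b))) ,
    (λ N cdc → partialSpread⇒code 1≤u (ℕₚ.m⊓n≤m _ _) (ℕₚ.m⊓n≤n _ _) (constantDimCode⇒partialSpread cdc))

open import Data.Nat using (_+_; _*_; _∸_; _≤_; _<_; _⊓_)
open import Data.Integer as ℤ using (+_; -[1+_]; 0ℤ; ∣_∣)
import Data.Integer.Properties as ℤₚ
import Data.Integer.DivMod as ℤDivMod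
import Data.Integer.Tactic.RingSolver as ℤ-Solver
import Data.Nat.Tactic.RingSolver as ℕ-Solver

-- Shifting i by one in either direction cannot increase min(a + i, b + (c ∸ i)).
Balanced : ℕ → ℕ → ℕ → ℕ → Set
Balanced a b c i = i ≤ c × (0 < i → a + i + i ≤ b + c) × (i < c → b + c ≤ a + i + i + 1)

a+i≤b+[c∸i] : ∀ a b c i → i ≤ c → a + i + i ≤ b + c → a + i ≤ b + (c ∸ i)
a+i≤b+[c∸i] a b c i i≤c a+i+i≤b+c =
  subst (a + i ≤_) (ℕₚ.+-∸-assoc b i≤c) (ℕₚ.m+n≤o⇒m≤o∸n (a + i) a+i+i≤b+c)

b+[c∸j]≤a+i : ∀ a b c i j → j ≤ c → i < j → b + c ≤ a + i + i + 1 → b + (c ∸ j) ≤ a + i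
b+[c∸j]≤a+i a b c i j j≤c i<j b+c≤a+i+i+1 = ℕₚ.+-cancelʳ-≤ j _ _ (begin
  b + (c ∸ j) + j ≡⟨ ℕₚ.+-assoc b (c ∸ j) j ⟩
  b + (c ∸ j + j) ≡⟨ cong (λ t → b + t) (ℕₚ.m∸n+n≡m j≤c) ⟩
  b + c           ≤⟨ b+c≤a+i+i+1 ⟩
  a + i + i + 1   ≡⟨ ℕₚ.+-assoc (a + i) i 1 ⟩
  a + i + (i + 1) ≡⟨ cong (λ t → a + i + t) (ℕₚ.+-comm i 1) ⟩
  a + i + suc i   ≤⟨ ℕₚ.+-monoʳ-≤ (a + i) i<j ⟩
  a + i + j       ∎)
  where open ℕₚ.≤-Reasoning

⊓≤b+[c∸i] : ∀ a b c i j → j ≤ i → i ≤ c → (0 < i → a + i + i ≤ b + c) →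
  (a + j) ⊓ (b + (c ∸ j)) ≤ b + (c ∸ i)
⊓≤b+[c∸i] a b c zero    zero j≤i i≤c _    = ℕₚ.m⊓n≤n _ _
⊓≤b+[c∸i] a b c (suc i) j    j≤i i≤c left = begin
  (a + j) ⊓ (b + (c ∸ j)) ≤⟨ ℕₚ.m⊓n≤m _ _ ⟩
  a + j                   ≤⟨ ℕₚ.+-monoʳ-≤ a j≤i ⟩
  a + suc i               ≤⟨ a+i≤b+[c∸i] a b c (suc i) i≤c (left (s≤s z≤n)) ⟩
  b + (c ∸ suc i)         ∎
  where open ℕₚ.≤-Reasoning

⊓-maximal-at-balanced : ∀ a b c i j → Balanced a b c i → j ≤ c →
  (a + j) ⊓ (b + (c ∸ j)) ≤ (a + i) ⊓ (b + (c ∸ i))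
⊓-maximal-at-balanced a b c i j (i≤c , left , right) j≤c with j ℕₚ.≤? i
... | yes j≤i = ℕₚ.⊓-glb (ℕₚ.≤-trans (ℕₚ.m⊓n≤m _ _) (ℕₚ.+-monoʳ-≤ a j≤i))
                         (⊓≤b+[c∸i] a b c i j j≤i i≤c left)
... | no  j≰i = ℕₚ.⊓-glb (ℕₚ.≤-trans (ℕₚ.m⊓n≤n _ _) (b+[c∸j]≤a+i a b c i j j≤c i<j (right (ℕₚ.<-≤-trans i<j j≤c))))
                         (ℕₚ.≤-trans (ℕₚ.m⊓n≤n _ _) (ℕₚ.+-monoʳ-≤ b (ℕₚ.∸-monoʳ-≤ c (ℕₚ.<⇒≤ i<j))))
  where
  i<j : i < j
  i<j = ℕₚ.≰⇒> j≰i

clamp-balanced : ∀ a b c r e → r ≤ 1 → + (b + c) ≡ + (a + r) ℤ.+ (e ℤ.+ e) →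
  ∃[ i ] (0ℤ ℤ.⊔ (+ c ℤ.⊓ e) ≡ + i × Balanced a b c i)
clamp-balanced a b c r -[1+ n ] r≤1 b+c≡ = 0 , refl , z≤n , (λ ()) , λ _ → begin
  b + c         ≤⟨ ℤₚ.drop‿+≤+ (subst (ℤ._≤ + (a + r)) (sym b+c≡) a+r+[e+e]≤a+r) ⟩
  a + r         ≤⟨ ℕₚ.+-monoʳ-≤ a r≤1 ⟩
  a + 1         ≡⟨ cong (λ t → t + 1) (sym (trans (ℕₚ.+-identityʳ _) (ℕₚ.+-identityʳ a))) ⟩
  a + 0 + 0 + 1 ∎
  where
  open ℕₚ.≤-Reasoning
  a+r+[e+e]≤a+r : + (a + r) ℤ.+ (-[1+ n ] ℤ.+ -[1+ n ]) ℤ.≤ + (a + r)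
  a+r+[e+e]≤a+r = ℤₚ.≤-trans (ℤₚ.+-monoʳ-≤ (+ (a + r)) ℤ.-≤+) (ℤₚ.≤-reflexive (ℤₚ.+-identityʳ _))
clamp-balanced a b c r (+ k) r≤1 b+c≡ = c ⊓ k , refl , ℕₚ.m⊓n≤m c k , (λ _ → left) , right
  where
  open ℕₚ.≤-Reasoning
  b+c≡a+r+[k+k] : b + c ≡ a + r + (k + k)
  b+c≡a+r+[k+k] = ℤₚ.+-injective (trans b+c≡ (sym (ℤₚ.pos-+ (a + r) (k + k))))
  left : a + c ⊓ k + c ⊓ k ≤ b + c
  left = begin
    a + c ⊓ k + c ⊓ k ≤⟨ ℕₚ.+-mono-≤ (ℕₚ.+-monoʳ-≤ a (ℕₚ.m⊓n≤n c k)) (ℕₚ.m⊓n≤n c k) ⟩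
    a + k + k         ≡⟨ ℕₚ.+-assoc a k k ⟩
    a + (k + k)       ≤⟨ ℕₚ.+-monoˡ-≤ (k + k) (ℕₚ.m≤m+n a r) ⟩
    a + r + (k + k)   ≡⟨ b+c≡a+r+[k+k] ⟨
    b + c             ∎
  rearrange : ∀ a k → a + 1 + (k + k) ≡ a + k + k + 1
  rearrange = ℕ-Solver.solve-∀
  right : c ⊓ k < c → b + c ≤ a + c ⊓ k + c ⊓ k + 1
  right c⊓k<c with ℕₚ.⊓-sel c k
  ... | inj₁ c⊓k≡c = ⊥-elim (ℕₚ.<-irrefl c⊓k≡c c⊓k<c)
  ... | inj₂ c⊓k≡k = begin
    b + c             ≡⟨ b+c≡a+r+[k+k] ⟩
    a + r + (k + k)   ≤⟨ ℕₚ.+-monoˡ-≤ (k + k) (ℕₚ.+-monoʳ-≤ a r≤1) ⟩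
    a + 1 + (k + k)   ≡⟨ rearrange a k ⟩
    a + k + k + 1     ≡⟨ cong (λ t → a + t + t + 1) c⊓k≡k ⟨
    a + c ⊓ k + c ⊓ k + 1 ∎

+m-+n≡+[m∸n] : ∀ {m n} → n ≤ m → + m ℤ.- + n ≡ + (m ∸ n)
+m-+n≡+[m∸n] {m} {n} n≤m = trans (ℤₚ.m-n≡m⊖n m n) (ℤₚ.⊖-≥ n≤m)

halving-identity : ∀ A B D U R Q →
  B ℤ.+ ((U ℤ.+ U) ℤ.- D) ≡
  (A ℤ.+ R) ℤ.+ ((Q ℤ.+ U) ℤ.+ (Q ℤ.+ U)) ℤ.+ ((B ℤ.- A ℤ.- D) ℤ.- (R ℤ.+ Q ℤ.* + 2))
halving-identity = ℤ-Solver.solve-∀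

-- optimalShift clamps e = ⌊(b − a − d)/2⌋ + u = ⌊(b + c − a)/2⌋ to [0, c], where c = 2u − d.
optimalShift-balanced : ∀ a b d u → d ≤ 2 * u → ∃[ i ] (optimalShift a b d u ≡ + i × Balanced a b (2 * u ∸ d) i)
optimalShift-balanced a b d u d≤2u =
  subst (λ T → ∃[ i ] (0ℤ ℤ.⊔ (T ℤ.⊓ e) ≡ + i × Balanced a b c i)) (sym T≡c)
        (clamp-balanced a b c r e (ℕₚ.≤-pred (ℤDivMod.n%ℕd<d Y 2)) halving)
  where
  c : ℕ
  c = 2 * u ∸ d
  T≡c : + (2 * u) ℤ.- + d ≡ + c
  T≡c = +m-+n≡+[m∸n] d≤2u
  Y : ℤ.ℤ
  Y = + b ℤ.- + a ℤ.- + d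
  r : ℕ
  r = Y ℤ.%ℕ 2
  e : ℤ.ℤ
  e = Y ℤ./ℕ 2 ℤ.+ + u
  halving : + (b + c) ≡ + (a + r) ℤ.+ (e ℤ.+ e)
  halving = begin
    + (b + c)                                  ≡⟨ ℤₚ.pos-+ b c ⟩
    + b ℤ.+ + c                                ≡⟨ cong (λ t → + b ℤ.+ t) T≡c ⟨
    + b ℤ.+ (+ (2 * u) ℤ.- + d)
      ≡⟨ cong (λ t → + b ℤ.+ (t ℤ.- + d)) (trans (cong +_ (sym (u+u≡2*u u))) (ℤₚ.pos-+ u u)) ⟩
    + b ℤ.+ ((+ u ℤ.+ + u) ℤ.- + d)            ≡⟨ halving-identity (+ a) (+ b) (+ d) (+ u) (+ r) (Y ℤ./ℕ 2) ⟩
    (+ a ℤ.+ + r) ℤ.+ (e ℤ.+ e) ℤ.+ (Y ℤ.- (+ r ℤ.+ Y ℤ./ℕ 2 ℤ.* + 2))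
      ≡⟨ cong (λ t → (+ a ℤ.+ + r) ℤ.+ (e ℤ.+ e) ℤ.+ (t ℤ.- (+ r ℤ.+ Y ℤ./ℕ 2 ℤ.* + 2))) (ℤDivMod.a≡a%ℕn+[a/ℕn]*n Y 2) ⟩
    (+ a ℤ.+ + r) ℤ.+ (e ℤ.+ e) ℤ.+ ((+ r ℤ.+ Y ℤ./ℕ 2 ℤ.* + 2) ℤ.- (+ r ℤ.+ Y ℤ./ℕ 2 ℤ.* + 2))
      ≡⟨ cong (λ t → (+ a ℤ.+ + r) ℤ.+ (e ℤ.+ e) ℤ.+ t) (ℤₚ.+-inverseʳ (+ r ℤ.+ Y ℤ./ℕ 2 ℤ.* + 2)) ⟩
    (+ a ℤ.+ + r) ℤ.+ (e ℤ.+ e) ℤ.+ 0ℤ          ≡⟨ ℤₚ.+-identityʳ _ ⟩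
    (+ a ℤ.+ + r) ℤ.+ (e ℤ.+ e)                ≡⟨ cong (ℤ._+ (e ℤ.+ e)) (ℤₚ.pos-+ a r) ⟨
    + (a + r) ℤ.+ (e ℤ.+ e)                    ∎
    where open ≡-Reasoning

optimalShift≤2u-d : ∀ a b d u → d ≤ 2 * u → optimalShift a b d u ℤ.≤ + (2 * u) ℤ.- + d
optimalShift≤2u-d a b d u d≤2u with optimalShift-balanced a b d u d≤2u
... | i , opt≡i , i≤c , _ = subst₂ ℤ._≤_ (sym opt≡i) (sym (+m-+n≡+[m∸n] d≤2u)) (ℤ.+≤+ i≤c)

optimalShift-optimal : ∀ a b d u j → d ≤ 2 * u → j + d ≤ 2 * u →
  (a + j) ⊓ (b + (2 * u ∸ (d + j))) ≤
  (a + ∣ optimalShift a b d u ∣) ⊓ (b + (2 * u ∸ (d + ∣ optimalShift a b d u ∣)))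
optimalShift-optimal a b d u j d≤2u j+d≤2u with optimalShift-balanced a b d u d≤2u
... | i , opt≡i , balanced rewrite opt≡i
                                | sym (ℕₚ.∸-+-assoc (2 * u) d j)
                                | sym (ℕₚ.∸-+-assoc (2 * u) d i) =
  ⊓-maximal-at-balanced a b (2 * u ∸ d) i j balanced (ℕₚ.m+n≤o⇒m≤o∸n j j+d≤2u)

1≤d⇒1≤u : ∀ {i d} u → 1 ≤ d → i + d ≤ 2 * u → 1 ≤ u
1≤d⇒1≤u {i} {d} zero    1≤d i+d≤0 = ⊥-elim (ℕₚ.<⇒≱ 1≤d (ℕₚ.≤-trans (ℕₚ.m≤n+m d i) i+d≤0))
1≤d⇒1≤u         (suc u) _   _     = s≤s z≤n

corollary13 : (q : ℕ) → IsPrimePower q → (Fq : FiniteField q) →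
  let open LinearAlgebra (FiniteField.field′ Fq) in
  (a b d u i : ℕ) → 1 ≤ d → i + d ≤ 2 * u →
    ΛLe (a + i) (b + (2 * u ∸ (d + i))) (2 * u) u a b d u
    × (u ≤ a + i → u ≤ b + (2 * u ∸ (d + i)) →
         ΛEqA (a + i) (b + (2 * u ∸ (d + i))) (2 * u) u
              ((a + i) ⊓ (b + (2 * u ∸ (d + i)))) (2 * u) u)
    × (ℤ.0ℤ ℤ.≤ optimalShift a b d u
       × optimalShift a b d u ℤ.≤ + (2 * u) ℤ.- + d
       × ((j : ℕ) → j + d ≤ 2 * u →
            ΛLe (a + j) (b + (2 * u ∸ (d + j))) (2 * u) u
                (a + ∣ optimalShift a b d u ∣)
                (b + (2 * u ∸ (d + ∣ optimalShift a b d u ∣))) (2 * u) u))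
corollary13 q _ Fq a b d u i 1≤d i+d≤2u =
  ΛLe-puncture a b d u i (2 * u) 1≤d (subst (_≤ 2 * u) (ℕₚ.+-comm i d) i+d≤2u) ,
  ΛEqA-⊓ 1≤u ,
  ( ℤₚ.i≤i⊔j 0ℤ _
  , optimalShift≤2u-d a b d u d≤2u
  , λ j j+d≤2u → ΛLe-⊓-monotone 1≤u (optimalShift-optimal a b d u j d≤2u j+d≤2u) )
  where
  open Puncturing (FiniteField.field′ Fq) (FiniteField.enumeration Fq) using (ΛLe-puncture)
  open SpreadBounds (FiniteField.field′ Fq) (FiniteField.enumeration Fq)
  d≤2u : d ≤ 2 * u
  d≤2u = ℕₚ.≤-trans (ℕₚ.m≤n+m d i) i+d≤2u
  1≤u : 1 ≤ u
  1≤u = 1≤d⇒1≤u u 1≤d i+d≤2u
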